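{- Let $k,n\in\mathbb{N}$ with $3\le k\le n$ and let $S=\{e_1,e_2,\ldots,e_k\}\subseteq C(n-1)$ (distinct vectors). Then $\tilde G(S)$ is a $k$-cycle if and only if $S$ is reduced and $e_1+e_2+\cdots+e_k=\mathbf{0}$.
   Context: $C(n-1)$ is the set of non-zero vectors in $\mathbb{Z}_2^{n-1}$ whose $1$'s appear in consecutive coordinates. For $S\subseteq C(n-1)$, $G(S)$ is the simple graph on vertex set $\{0,1,\ldots,n-1\}$ in which each $e\in S$ whose stretch of $1$'s runs from the $i$-th to the $j$-th coordinate (from the left) is an edge joining vertices $n-i$ and $n-j-1$; $\tilde G(S)$ is $G(S)$ with isolated vertices removed. A non-empty set $S$ of non-zero vectors of $\mathbb{Z}_2^{n-1}$ is reduced if $\sum_{e\in A}e\neq\mathbf{0}$ for every non-empty proper subset $A\subsetneq S$. -}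

module Defs where

open import Data.Nat using (ℕ; zero; suc; _+_; _<_; _≤_; _∸_; _<?_; s≤s)
open import Relation.Nullary using (yes; no)
open import Data.Fin using (Fin; toℕ; fromℕ<) renaming (zero to fzero; suc to fsuc)
open import Data.Bool using (Bool; true; false; _xor_; if_then_else_)
open import Data.Vec using (Vec; lookup; replicate; zipWith)
open import Data.Product using (Σ; ∃; ∃-syntax; _×_; _,_)
open import Data.Sum using (_⊎_)
open import Relation.Binary.PropositionalEquality using (_≡_; _≢_)
open import Function.Definitions using (Injective)

-- Vectors of ℤ₂^d are Vec Bool d (true = 1), addition is coordinatewise xor.
𝟎 : ∀ {d} → Vec Bool d
𝟎 = replicate _ false

_⊕_ : ∀ {d} → Vec Bool d → Vec Bool d → Vec Bool d
_⊕_ = zipWith _xor_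

Σv : ∀ {d} (k : ℕ) → (Fin k → Vec Bool d) → Vec Bool d
Σv zero    f = 𝟎
Σv (suc k) f = f fzero ⊕ Σv k (λ m → f (fsuc m))

Σsel : ∀ {d} (k : ℕ) → (Fin k → Vec Bool d) → (Fin k → Bool) → Vec Bool d
Σsel k f A = Σv k (λ m → if A m then f m else 𝟎)

InC : ∀ {d} → Vec Bool d → Set
InC {d} v = (v ≢ 𝟎) ×
  (∀ (a b c : Fin d) → toℕ a < toℕ b → toℕ b < toℕ c →
     lookup v a ≡ true → lookup v c ≡ true → lookup v b ≡ true)

-- the stretch of 1's of v runs from coordinate i to coordinate j (0-indexed)
Stretch : ∀ {d} → Vec Bool d → Fin d → Fin d → Set
Stretch {d} v i j = (lookup v i ≡ true) × (lookup v j ≡ true) ×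
  (∀ (c : Fin d) → lookup v c ≡ true → (toℕ i ≤ toℕ c) × (toℕ c ≤ toℕ j))

-- v (in ℤ₂^(n-1)) is the edge of G joining vertices a and b of {0,…,n-1}.
-- With 1-indexed stretch i' = i+1, j' = j+1, the endpoints are n-i' and n-j'-1,
-- i.e. a + i + 1 = n and b + j + 2 = n.
EdgeOf : (n : ℕ) → Vec Bool (n ∸ 1) → Fin n → Fin n → Set
EdgeOf n v a b = ∃[ i ] ∃[ j ] Stretch v i j ×
  (   ((toℕ a + toℕ i + 1 ≡ n) × (toℕ b + toℕ j + 2 ≡ n))
    ⊎ ((toℕ b + toℕ i + 1 ≡ n) × (toℕ a + toℕ j + 2 ≡ n)))

Adj : (n k : ℕ) → (Fin k → Vec Bool (n ∸ 1)) → Fin n → Fin n → Set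
Adj n k e a b = ∃[ m ] EdgeOf n (e m) a b

sucMod : ∀ {k} → Fin k → Fin k
sucMod {suc k} m with toℕ m <? k
... | yes p = fromℕ< {suc (toℕ m)} (s≤s p)
... | no _ = fzero

-- G̃(S) is a k-cycle: there are k distinct vertices v₀,…,v_{k-1} of G(S) such that
-- the edges of G(S) are exactly {v_t, v_{t+1 mod k}}; the non-isolated vertices are
-- then exactly the v_t, so G̃(S) is the cycle v₀ v₁ … v_{k-1} v₀.
IsKCycle : (n k : ℕ) → (Fin k → Vec Bool (n ∸ 1)) → Set
IsKCycle n k e = Σ (Fin k → Fin n) λ v → Injective _≡_ _≡_ v ×
  (∀ (a b : Fin n) → (Adj n k e a b →
       ∃[ t ] ((a ≡ v t × b ≡ v (sucMod t)) ⊎ (b ≡ v t × a ≡ v (sucMod t))))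
    × (∀ t → (a ≡ v t × b ≡ v (sucMod t)) ⊎ (b ≡ v t × a ≡ v (sucMod t)) → Adj n k e a b))

Reduced : ∀ {d} (k : ℕ) → (Fin k → Vec Bool d) → Set
Reduced k e = ∀ (A : Fin k → Bool) → (∃[ m ] A m ≡ true) → (∃[ m ] A m ≡ false) →
  Σsel k e A ≢ 𝟎

module Submission where

-- A vector of C(n-1) with stretch i..j is the indicator of the interval
-- [i, j+1) of coordinates; under the relabelling a ↦ n-1-a of the vertices of
-- G(S) it is exactly the edge {i, j+1}.  So S is the edge list of a simple graph
-- on ℕ whose edges are the pairs lo < hi of its intervals.  The indicator of
-- [lo, hi) is the xor of the rays [lo, ∞) and [hi, ∞), whose discrete
-- derivative is supported on {lo, hi}; hence a subfamily A sums to 0 iff every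
-- vertex has even degree in A ("A is even").  The statement thus becomes the
-- graph-theoretic fact that the edge set is a single cycle iff it is even and
-- no proper non-empty part of it is even (a minimal even set).  One direction
-- counts incident cycle edges; for the other, a non-backtracking walk (possible
-- because all degrees are even) first repeats a vertex along a cycle, whose edge
-- set is even, hence by minimality the whole edge set.

open import Defs
open import Data.Nat using (ℕ; _≤_; _∸_)
open import Data.Fin using (Fin)
open import Data.Bool using (Bool)
open import Data.Vec using (Vec)
open import Data.Product using (_×_)
open import Relation.Binary.PropositionalEquality using (_≡_)
open import Function.Definitions using (Injective)
open import Function.Bundles using (_⇔_)

open import Algebra.Bundles using (CommutativeRing)
open import Data.Nat using (zero; suc; _+_; _<_; z≤n; s≤s; s≤s⁻¹; _≤?_; _<?_; _≟_)
import Data.Nat.Properties as ℕ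
open import Data.Nat.Induction using (<-rec)
open import Data.Fin using (toℕ; fromℕ; fromℕ<; inject₁; opposite) renaming (zero to fzero; suc to fsuc)
import Data.Fin.Properties as Fin
open import Data.Bool using (true; false; _∧_; _xor_; if_then_else_)
import Data.Bool.Properties as Bool
open import Data.Vec using (lookup)
open import Data.Vec.Properties using (lookup-zipWith; lookup-replicate; tabulate∘lookup; tabulate-cong)
open import Data.Product using (Σ; ∃-syntax; _,_; proj₁; proj₂; map₂)
open import Data.Product.Function.NonDependent.Propositional using (_×-⇔_)
open import Data.Sum using (_⊎_; inj₁; inj₂; [_,_]′)
open import Data.Empty using (⊥; ⊥-elim)
open import Function.Base using (_∘_)
open import Function.Bundles using (mk⇔; Equivalence)
import Function.Properties.Equivalence as ⇔
open import Relation.Nullary using (¬_; Dec; yes; no; does; contradiction)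
open import Relation.Nullary.Decidable using (dec-true; dec-false; _×-dec_; ¬?)
open import Relation.Binary.PropositionalEquality
  using (_≢_; refl; sym; trans; cong; cong₂; subst; subst₂; module ≡-Reasoning)
open import Algebra.Properties.CommutativeSemigroup
  (CommutativeRing.+-commutativeSemigroup Bool.xor-∧-commutativeRing) using (interchange)
open import Relation.Binary.Definitions using (tri<; tri≈; tri>)

open Equivalence using (to; from)

does-sound : ∀ {P : Set} (P? : Dec P) → does P? ≡ true → P
does-sound (yes p) _ = p
does-sound (no _) ()

≡-from-true : ∀ {a b : Bool} → (a ≡ true ⇔ b ≡ true) → a ≡ b
≡-from-true {false} {false} _   = refl
≡-from-true {false} {true}  a⇔b = from a⇔b refl
≡-from-true {true}  {false} a⇔b = sym (to a⇔b refl)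
≡-from-true {true}  {true}  _   = refl

xor-true : ∀ a b → a xor b ≡ true → (a ≡ true × b ≡ false) ⊎ (a ≡ false × b ≡ true)
xor-true true  false _ = inj₁ (refl , refl)
xor-true false true  _ = inj₂ (refl , refl)

∧-false : ∀ {a b : Bool} → (a ≡ true → b ≡ true → ⊥) → a ∧ b ≡ false
∧-false {false}         _ = refl
∧-false {true} {false}  _ = refl
∧-false {true} {true} ¬ab = ⊥-elim (¬ab refl refl)

parity : (k : ℕ) → (Fin k → Bool) → Bool
parity zero    f = false
parity (suc k) f = f fzero xor parity k (f ∘ fsuc)

parity-cong : ∀ k {f g : Fin k → Bool} → (∀ m → f m ≡ g m) → parity k f ≡ parity k g
parity-cong zero    f≗g = refl
parity-cong (suc k) f≗g = cong₂ _xor_ (f≗g fzero) (parity-cong k (f≗g ∘ fsuc))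

parity-xor : ∀ k (f g : Fin k → Bool) →
  parity k f xor parity k g ≡ parity k (λ m → f m xor g m)
parity-xor zero    f g = refl
parity-xor (suc k) f g =
  trans (interchange (f fzero) (parity k (f ∘ fsuc)) (g fzero) (parity k (g ∘ fsuc)))
        (cong ((f fzero xor g fzero) xor_) (parity-xor k (f ∘ fsuc) (g ∘ fsuc)))

parity-none : ∀ k (f : Fin k → Bool) → (∀ m → f m ≡ false) → parity k f ≡ false
parity-none zero    f none = refl
parity-none (suc k) f none rewrite none fzero = parity-none k (f ∘ fsuc) (none ∘ fsuc)

parity-one : ∀ k (f : Fin k → Bool) m₀ → f m₀ ≡ true →
  (∀ m → m ≢ m₀ → f m ≡ false) → parity k f ≡ true
parity-one (suc k) f fzero f₀ rest
  rewrite f₀ | parity-none k (f ∘ fsuc) (λ m → rest (fsuc m) λ ()) = refl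
parity-one (suc k) f (fsuc m₀) f₀ rest rewrite rest fzero (λ ()) =
  parity-one k (f ∘ fsuc) m₀ f₀ (λ m m≢m₀ → rest (fsuc m) (m≢m₀ ∘ Fin.suc-injective))

parity-two : ∀ k (f : Fin k → Bool) m₁ m₂ → m₁ ≢ m₂ → f m₁ ≡ true → f m₂ ≡ true →
  (∀ m → m ≢ m₁ → m ≢ m₂ → f m ≡ false) → parity k f ≡ false
parity-two (suc k) f fzero fzero m₁≢m₂ _ _ _ = contradiction refl m₁≢m₂
parity-two (suc k) f fzero (fsuc m₂) _ f₁ f₂ rest
  rewrite f₁ | parity-one k (f ∘ fsuc) m₂ f₂
                 (λ m m≢m₂ → rest (fsuc m) (λ ()) (m≢m₂ ∘ Fin.suc-injective)) = refl
parity-two (suc k) f (fsuc m₁) fzero _ f₁ f₂ rest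
  rewrite f₂ | parity-one k (f ∘ fsuc) m₁ f₁
                 (λ m m≢m₁ → rest (fsuc m) (m≢m₁ ∘ Fin.suc-injective) (λ ())) = refl
parity-two (suc k) f (fsuc m₁) (fsuc m₂) m₁≢m₂ f₁ f₂ rest rewrite rest fzero (λ ()) (λ ()) =
  parity-two k (f ∘ fsuc) m₁ m₂ (m₁≢m₂ ∘ cong fsuc) f₁ f₂
    (λ m m≢m₁ m≢m₂ → rest (fsuc m) (m≢m₁ ∘ Fin.suc-injective) (m≢m₂ ∘ Fin.suc-injective))

lookup-ext : ∀ {d} (u v : Vec Bool d) → (∀ c → lookup u c ≡ lookup v c) → u ≡ v
lookup-ext u v u≗v =
  trans (sym (tabulate∘lookup u)) (trans (tabulate-cong u≗v) (tabulate∘lookup v))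

lookup-𝟎 : ∀ {d} (c : Fin d) → lookup (𝟎 {d}) c ≡ false
lookup-𝟎 c = lookup-replicate c false

lookup-Σv : ∀ {d} k (f : Fin k → Vec Bool d) c →
  lookup (Σv k f) c ≡ parity k (λ m → lookup (f m) c)
lookup-Σv zero    f c = lookup-𝟎 c
lookup-Σv (suc k) f c = trans (lookup-zipWith _xor_ c (f fzero) (Σv k (f ∘ fsuc)))
                              (cong (lookup (f fzero) c xor_) (lookup-Σv k (f ∘ fsuc) c))

lookup-Σsel : ∀ {d} k (f : Fin k → Vec Bool d) A c →
  lookup (Σsel k f A) c ≡ parity k (λ m → A m ∧ lookup (f m) c)
lookup-Σsel k f A c = trans (lookup-Σv k _ c) (parity-cong k (λ m → selected (A m) (f m)))
  where
  selected : ∀ b v → lookup (if b then v else 𝟎) c ≡ b ∧ lookup v c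
  selected true  v = refl
  selected false v = lookup-𝟎 c

ray : ℕ → ℕ → Bool
ray l c = does (l ≤? c)

point : ℕ → ℕ → Bool
point p q = does (q ≟ p)

ray-true : ∀ {l c} → ray l c ≡ true ⇔ l ≤ c
ray-true {l} {c} = mk⇔ (does-sound (l ≤? c)) (dec-true (l ≤? c))

ray-false : ∀ {l c} → ray l c ≡ false ⇔ (¬ l ≤ c)
ray-false {l} {c} = mk⇔ (λ r l≤c → contradiction (trans (sym r) (dec-true (l ≤? c) l≤c)) λ ())
                        (dec-false (l ≤? c))

ray-start : ∀ l → ray l 0 ≡ point l 0
ray-start zero    = refl
ray-start (suc l) = refl

ray-jump : ∀ l c → ray l c xor ray l (suc c) ≡ point l (suc c)
ray-jump zero          c       = refl
ray-jump (suc zero)    zero    = refl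
ray-jump (suc (suc l)) zero    = refl
ray-jump (suc zero)    (suc c) = refl
ray-jump (suc (suc l)) (suc c) = ray-jump (suc l) c

-- For l ≤ h, the xor of the rays at l and h is the indicator of [l, h); its
-- discrete derivative is supported on the two endpoints.
interval : ℕ → ℕ → ℕ → Bool
interval l h c = ray l c xor ray h c

interval-start : ∀ l h → interval l h 0 ≡ point l 0 xor point h 0
interval-start l h = cong₂ _xor_ (ray-start l) (ray-start h)

interval-jump : ∀ l h c → interval l h c xor interval l h (suc c) ≡ point l (suc c) xor point h (suc c)
interval-jump l h c = trans (interchange (ray l c) (ray h c) (ray l (suc c)) (ray h (suc c)))
                            (cong₂ _xor_ (ray-jump l c) (ray-jump h c))

interval-member : ∀ {l h} c → l ≤ h → interval l h c ≡ true ⇔ (l ≤ c × c < h)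
interval-member {l} {h} c l≤h = mk⇔ inside⇒ inside⇐
  where
  inside⇒ : interval l h c ≡ true → l ≤ c × c < h
  inside⇒ lh with xor-true (ray l c) (ray h c) lh
  ... | inj₁ (l≤c , h≰c) = to ray-true l≤c , ℕ.≰⇒> (to ray-false h≰c)
  ... | inj₂ (l≰c , h≤c) = contradiction (ℕ.≤-trans l≤h (to ray-true h≤c)) (to ray-false l≰c)
  inside⇐ : l ≤ c × c < h → interval l h c ≡ true
  inside⇐ (l≤c , c<h) = cong₂ _xor_ (dec-true (l ≤? c) l≤c) (dec-false (h ≤? c) (ℕ.<⇒≱ c<h))

nonzero-true : ∀ {d} (v : Vec Bool d) → v ≢ 𝟎 → ∃[ c ] lookup v c ≡ true
nonzero-true v v≢𝟎 with Fin.any? (λ c → lookup v c Bool.≟ true)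
... | yes found = found
... | no none = contradiction (lookup-ext v 𝟎 λ c →
                  trans (Bool.¬-not (λ vc → none (c , vc))) (sym (lookup-𝟎 c))) v≢𝟎

first-true : ∀ {d} (f : Fin d → Bool) → ∃[ c ] f c ≡ true →
  ∃[ i ] f i ≡ true × (∀ c → f c ≡ true → toℕ i ≤ toℕ c)
first-true {suc d} f found with f fzero in f₀
... | true = fzero , f₀ , λ _ _ → z≤n
... | false with found
...   | fzero  , fc = contradiction (trans (sym fc) f₀) λ ()
...   | fsuc c , fc with first-true (f ∘ fsuc) (c , fc)
...     | i , fi , least = fsuc i , fi , λ
          { fzero fc′ → contradiction (trans (sym fc′) f₀) λ ()
          ; (fsuc c′) fc′ → s≤s (least c′ fc′) }

last-true : ∀ {d} (f : Fin d → Bool) → ∃[ c ] f c ≡ true →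
  ∃[ j ] f j ≡ true × (∀ c → f c ≡ true → toℕ c ≤ toℕ j)
last-true {suc d} f found with Fin.any? (λ c → f (fsuc c) Bool.≟ true)
... | yes later with last-true (f ∘ fsuc) later
...   | j , fj , greatest = fsuc j , fj , λ { fzero _ → z≤n ; (fsuc c) fc → s≤s (greatest c fc) }
last-true {suc d} f (fzero , f₀) | no none =
  fzero , f₀ , λ { fzero _ → z≤n ; (fsuc c) fc → contradiction (c , fc) none }
last-true {suc d} f (fsuc c , fc) | no none = contradiction (c , fc) none

stretch-of : ∀ {d} {v : Vec Bool d} → InC v → ∃[ i ] ∃[ j ] Stretch v i j
stretch-of {v = v} (v≢𝟎 , _) with first-true (lookup v) (nonzero-true v v≢𝟎)
                                 | last-true (lookup v) (nonzero-true v v≢𝟎)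
... | i , vi , least | j , vj , greatest = i , j , vi , vj , λ c vc → least c vc , greatest c vc

stretch-unique : ∀ {d} {v : Vec Bool d} {i j i′ j′} → Stretch v i j → Stretch v i′ j′ →
  toℕ i ≡ toℕ i′ × toℕ j ≡ toℕ j′
stretch-unique (vi , vj , bounds) (vi′ , vj′ , bounds′) =
  ℕ.≤-antisym (proj₁ (bounds _ vi′)) (proj₁ (bounds′ _ vi)) ,
  ℕ.≤-antisym (proj₂ (bounds′ _ vj)) (proj₂ (bounds _ vj′))

stretch-ordered : ∀ {d} {v : Vec Bool d} {i j} → Stretch v i j → toℕ i ≤ toℕ j
stretch-ordered (_ , vj , bounds) = proj₁ (bounds _ vj)

stretch-members : ∀ {d} {v : Vec Bool d} → InC v → ∀ {i j} → Stretch v i j →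
  ∀ c → lookup v c ≡ true ⇔ (toℕ i ≤ toℕ c × toℕ c ≤ toℕ j)
stretch-members {v = v} (_ , convex) {i} {j} (vi , vj , bounds) c = mk⇔ (bounds c) inside
  where
  inside : toℕ i ≤ toℕ c × toℕ c ≤ toℕ j → lookup v c ≡ true
  inside (i≤c , c≤j) with ℕ.m≤n⇒m<n∨m≡n i≤c | ℕ.m≤n⇒m<n∨m≡n c≤j
  ... | inj₂ i≡c | _        = subst (λ x → lookup v x ≡ true) (Fin.toℕ-injective i≡c) vi
  ... | inj₁ _   | inj₂ c≡j = subst (λ x → lookup v x ≡ true) (Fin.toℕ-injective (sym c≡j)) vj
  ... | inj₁ i<c | inj₁ c<j = convex i c j i<c c<j vi vj

lookup-stretch : ∀ {d} {v : Vec Bool d} → InC v → ∀ {i j} → Stretch v i j →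
  ∀ c → lookup v c ≡ interval (toℕ i) (suc (toℕ j)) (toℕ c)
lookup-stretch {v = v} v∈C s c = ≡-from-true (⇔.trans (stretch-members v∈C s c)
  (⇔.sym (⇔.trans (interval-member (toℕ c) (ℕ.m≤n⇒m≤1+n (stretch-ordered {v = v} s)))
                  (mk⇔ (map₂ s≤s⁻¹) (map₂ s≤s)))))

sucMod-cases : ∀ {L} (t : Fin (suc L)) →
  (toℕ t < L × toℕ (sucMod t) ≡ suc (toℕ t)) ⊎ (toℕ t ≡ L × sucMod t ≡ fzero)
sucMod-cases {L} t with toℕ t <? L
... | yes t<L = inj₁ (t<L , Fin.toℕ-fromℕ< (s≤s t<L))
... | no  t≮L = inj₂ (ℕ.≤-antisym (s≤s⁻¹ (Fin.toℕ<n t)) (ℕ.≮⇒≥ t≮L) , refl)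

sucMod-injective : ∀ {L} → Injective _≡_ _≡_ (sucMod {suc L})
sucMod-injective {x = t} {t′} st≡st′ with sucMod-cases t | sucMod-cases t′
... | inj₁ (_ , st) | inj₁ (_ , st′) =
  Fin.toℕ-injective (ℕ.suc-injective (trans (sym st) (trans (cong toℕ st≡st′) st′)))
... | inj₂ (t≡L , _) | inj₂ (t′≡L , _) = Fin.toℕ-injective (trans t≡L (sym t′≡L))
... | inj₁ (_ , st) | inj₂ (_ , st′≡0) = contradiction (trans (sym st) (cong toℕ (trans st≡st′ st′≡0))) λ ()
... | inj₂ (_ , st≡0) | inj₁ (_ , st′) = contradiction (trans (sym st′) (cong toℕ (trans (sym st≡st′) st≡0))) λ ()

sucMod-moves : ∀ {L} → 1 ≤ L → (t : Fin (suc L)) → sucMod t ≢ t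
sucMod-moves 1≤L t st≡t with sucMod-cases t
... | inj₁ (_ , st) = ℕ.m≢1+n+m (toℕ t) (trans (sym (cong toℕ st≡t)) st)
... | inj₂ (t≡L , st≡0) =
  contradiction (trans (sym t≡L) (cong toℕ (trans (sym st≡t) st≡0))) (ℕ.m<n⇒n≢0 1≤L)

sucMod²-moves : ∀ {L} → 2 ≤ L → (t : Fin (suc L)) → sucMod (sucMod t) ≢ t
sucMod²-moves {L} 2≤L t sst≡t with sucMod-cases t | sucMod-cases (sucMod t)
... | inj₁ (_ , st) | inj₁ (_ , sst) =
  ℕ.m≢1+n+m (toℕ t) {1} (trans (sym (cong toℕ sst≡t)) (trans sst (cong suc st)))
... | inj₁ (_ , st) | inj₂ (st≡L , sst≡0) =
  ℕ.<⇒≱ 2≤L (ℕ.≤-reflexive (trans (sym st≡L) (trans st (cong (suc ∘ toℕ) (trans (sym sst≡t) sst≡0)))))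
... | inj₂ (t≡L , st≡0) | inj₁ (_ , sst) =
  ℕ.<⇒≱ 2≤L (ℕ.≤-reflexive (trans (sym t≡L) (trans (cong toℕ (sym sst≡t))
                                      (trans sst (cong (suc ∘ toℕ) st≡0)))))
... | inj₂ (_ , st≡0) | inj₂ (st≡L , _) =
  ℕ.<⇒≱ 2≤L (ℕ.m≤n⇒m≤1+n (ℕ.≤-reflexive (trans (sym st≡L) (cong toℕ st≡0))))

sucMod-surjective : ∀ {L} (t : Fin (suc L)) → ∃[ p ] sucMod p ≡ t
sucMod-surjective {L} fzero with sucMod-cases (fromℕ L)
... | inj₁ (L<L , _) = contradiction (subst (_< L) (Fin.toℕ-fromℕ L) L<L) (ℕ.<-irrefl refl)
... | inj₂ (_ , last↦0) = fromℕ L , last↦0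
sucMod-surjective {suc L} (fsuc t) with sucMod-cases (inject₁ t)
... | inj₁ (_ , st) = inject₁ t , Fin.toℕ-injective (trans st (cong suc (Fin.toℕ-inject₁ t)))
... | inj₂ (t≡L , _) =
  contradiction (trans (sym (Fin.toℕ-inject₁ t)) t≡L) (ℕ.<⇒≢ (Fin.toℕ<n t))

sucMod-closed : ∀ {L} (B : Fin (suc L) → Bool) → (∀ t → B t ≡ true → B (sucMod t) ≡ true) →
  ∀ {t₀} → B t₀ ≡ true → ∀ t → B t ≡ true
sucMod-closed {L} B closed {t₀} Bt₀ t =
  subst holds (Fin.fromℕ<-toℕ t _) (reach B₀ (toℕ t) z≤n (Fin.toℕ<n t))
  where
  holds : Fin (suc L) → Set
  holds s = B s ≡ true
  at : ∀ {s c} (c<1+L : c < suc L) → toℕ s ≡ c → holds s → holds (fromℕ< c<1+L)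
  at c<1+L s≡c = subst holds (Fin.toℕ-injective (trans s≡c (sym (Fin.toℕ-fromℕ< c<1+L))))
  next : ∀ {c} (c+1<1+L : suc c < suc L) →
    sucMod (fromℕ< (ℕ.<-trans (ℕ.n<1+n c) c+1<1+L)) ≡ fromℕ< c+1<1+L
  next {c} c+1<1+L with sucMod-cases (fromℕ< (ℕ.<-trans (ℕ.n<1+n c) c+1<1+L))
  ... | inj₁ (_ , st) = Fin.toℕ-injective
        (trans st (trans (cong suc (Fin.toℕ-fromℕ< _)) (sym (Fin.toℕ-fromℕ< c+1<1+L))))
  ... | inj₂ (c≡L , _) =
        contradiction (trans (sym (Fin.toℕ-fromℕ< _)) c≡L) (ℕ.<⇒≢ (s≤s⁻¹ c+1<1+L))
  reach : ∀ {s} → holds s → ∀ c → toℕ s ≤ c → (c<1+L : c < suc L) → holds (fromℕ< c<1+L)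
  reach Bs zero    s≤0 0<1+L = at 0<1+L (ℕ.n≤0⇒n≡0 s≤0) Bs
  reach Bs (suc c) s≤c+1 c+1<1+L with ℕ.m≤n⇒m<n∨m≡n s≤c+1
  ... | inj₁ s<c+1 = subst holds (next c+1<1+L) (closed _ (reach Bs c (s≤s⁻¹ s<c+1) (ℕ.<-trans (ℕ.n<1+n c) c+1<1+L)))
  ... | inj₂ s≡c+1 = at c+1<1+L s≡c+1 Bs
  B₀ : holds fzero
  B₀ with sucMod-cases (fromℕ< (ℕ.n<1+n L))
  ... | inj₁ (L<L , _) = contradiction (subst (_< L) (Fin.toℕ-fromℕ< _) L<L) (ℕ.<-irrefl refl)
  ... | inj₂ (_ , last↦0) =
        subst holds last↦0 (closed _ (reach Bt₀ L (s≤s⁻¹ (Fin.toℕ<n t₀)) (ℕ.n<1+n L)))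

boundary : ∀ {L} (B : Fin (suc L) → Bool) {t₁ t₂} → B t₁ ≡ true → B t₂ ≡ false →
  ∃[ t ] B t ≡ true × B (sucMod t) ≡ false
boundary B Bt₁ Bt₂ with Fin.any? (λ t → (B t Bool.≟ true) ×-dec (B (sucMod t) Bool.≟ false))
... | yes found = found
... | no none = contradiction (trans (sym Bt₂) (sucMod-closed B closed Bt₁ _)) λ ()
  where
  closed : ∀ t → B t ≡ true → B (sucMod t) ≡ true
  closed t Bt = Bool.¬-not (λ Bst → none (t , Bt , Bst))

least : ∀ {P : ℕ → Set} → (∀ n → Dec (P n)) → ∀ {n} → P n →
  ∃[ m ] P m × (∀ m′ → m′ < m → ¬ P m′)
least {P} P? {n} = <-rec (λ n → P n → Least) search n
  where
  Least : Set
  Least = ∃[ m ] P m × (∀ m′ → m′ < m → ¬ P m′)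
  search : ∀ n → (∀ {m} → m < n → P m → Least) → P n → Least
  search n smaller Pn with ℕ.anyUpTo? P? n
  ... | yes (m , m<n , Pm) = smaller m<n Pm
  ... | no none = n , Pn , λ m m<n Pm → none (m , m<n , Pm)

module IntervalGraph {k : ℕ} (lo hi : Fin k → ℕ) (lo<hi : ∀ m → lo m < hi m)
  (simple : ∀ {m m′} → lo m ≡ lo m′ → hi m ≡ hi m′ → m ≡ m′) where

  Joins : Fin k → ℕ → ℕ → Set
  Joins m x y = (lo m ≡ x × hi m ≡ y) ⊎ (lo m ≡ y × hi m ≡ x)

  joins-sym : ∀ {m x y} → Joins m x y → Joins m y x
  joins-sym (inj₁ ends) = inj₂ ends
  joins-sym (inj₂ ends) = inj₁ ends

  joins-loop : ∀ {m x} → ¬ Joins m x x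
  joins-loop {m} (inj₁ (lo≡x , hi≡x)) = ℕ.<⇒≢ (lo<hi m) (trans lo≡x (sym hi≡x))
  joins-loop {m} (inj₂ (lo≡x , hi≡x)) = ℕ.<⇒≢ (lo<hi m) (trans lo≡x (sym hi≡x))

  joins-endpoints : ∀ {m x y x′ y′} → Joins m x y → Joins m x′ y′ →
    (x ≡ x′ × y ≡ y′) ⊎ (x ≡ y′ × y ≡ x′)
  joins-endpoints (inj₁ (a , b)) (inj₁ (a′ , b′)) = inj₁ (trans (sym a) a′ , trans (sym b) b′)
  joins-endpoints (inj₁ (a , b)) (inj₂ (a′ , b′)) = inj₂ (trans (sym a) a′ , trans (sym b) b′)
  joins-endpoints (inj₂ (a , b)) (inj₁ (a′ , b′)) = inj₂ (trans (sym b) b′ , trans (sym a) a′)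
  joins-endpoints (inj₂ (a , b)) (inj₂ (a′ , b′)) = inj₁ (trans (sym b) b′ , trans (sym a) a′)

  joins-edge : ∀ {m m′ x y} → Joins m x y → Joins m′ x y → m ≡ m′
  joins-edge (inj₁ (a , b)) (inj₁ (a′ , b′)) = simple (trans a (sym a′)) (trans b (sym b′))
  joins-edge (inj₂ (a , b)) (inj₂ (a′ , b′)) = simple (trans a (sym a′)) (trans b (sym b′))
  joins-edge {m} {m′} (inj₁ (a , b)) (inj₂ (a′ , b′)) =
    contradiction (subst₂ _<_ a′ b′ (lo<hi m′)) (ℕ.<-asym (subst₂ _<_ a b (lo<hi m)))
  joins-edge {m} {m′} (inj₂ (a , b)) (inj₁ (a′ , b′)) =
    contradiction (subst₂ _<_ a′ b′ (lo<hi m′)) (ℕ.<-asym (subst₂ _<_ a b (lo<hi m)))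

  incident : Fin k → ℕ → Bool
  incident m p = point (lo m) p xor point (hi m) p

  incident-endpoint : ∀ {m p} → incident m p ≡ true → p ≡ lo m ⊎ p ≡ hi m
  incident-endpoint {m} {p} m∋p with xor-true (point (lo m) p) (point (hi m) p) m∋p
  ... | inj₁ (p≡lo , _) = inj₁ (does-sound (p ≟ lo m) p≡lo)
  ... | inj₂ (_ , p≡hi) = inj₂ (does-sound (p ≟ hi m) p≡hi)

  joins-incident : ∀ {m x y} → Joins m x y → incident m x ≡ true
  joins-incident {m} (inj₁ (refl , _)) =
    cong₂ _xor_ (dec-true (lo m ≟ lo m) refl) (dec-false (lo m ≟ hi m) (ℕ.<⇒≢ (lo<hi m)))
  joins-incident {m} (inj₂ (_ , refl)) =
    cong₂ _xor_ (dec-false (hi m ≟ lo m) (ℕ.<⇒≢ (lo<hi m) ∘ sym)) (dec-true (hi m ≟ hi m) refl)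

  incident-joins : ∀ {m p x y} → incident m p ≡ true → Joins m x y → p ≡ x ⊎ p ≡ y
  incident-joins m∋p (inj₁ (lo≡x , hi≡y)) with incident-endpoint m∋p
  ... | inj₁ p≡lo = inj₁ (trans p≡lo lo≡x)
  ... | inj₂ p≡hi = inj₂ (trans p≡hi hi≡y)
  incident-joins m∋p (inj₂ (lo≡y , hi≡x)) with incident-endpoint m∋p
  ... | inj₁ p≡lo = inj₂ (trans p≡lo lo≡y)
  ... | inj₂ p≡hi = inj₁ (trans p≡hi hi≡x)

  joins-below : ∀ {N m x y} → (∀ m → hi m < N) → Joins m x y → x < N × y < N
  joins-below {m = m} hi<N (inj₁ (refl , refl)) = ℕ.<-trans (lo<hi m) (hi<N m) , hi<N m
  joins-below {m = m} hi<N (inj₂ (refl , refl)) = hi<N m , ℕ.<-trans (lo<hi m) (hi<N m)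

  odd-degree : (Fin k → Bool) → ℕ → Bool
  odd-degree A p = parity k (λ m → A m ∧ incident m p)

  Even : (Fin k → Bool) → Set
  Even A = ∀ p → odd-degree A p ≡ false

  Minimal : Set
  Minimal = ∀ A → ∃[ m ] A m ≡ true → ∃[ m ] A m ≡ false → ¬ Even A

  layer : (Fin k → Bool) → ℕ → Bool
  layer A c = parity k (λ m → A m ∧ interval (lo m) (hi m) c)

  layer-start : ∀ A → layer A 0 ≡ odd-degree A 0
  layer-start A = parity-cong k λ m → cong (A m ∧_) (interval-start (lo m) (hi m))

  layer-jump : ∀ A c → layer A c xor layer A (suc c) ≡ odd-degree A (suc c)
  layer-jump A c = trans (parity-xor k _ _) (parity-cong k λ m → begin
    (A m ∧ interval (lo m) (hi m) c) xor (A m ∧ interval (lo m) (hi m) (suc c))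
      ≡⟨ Bool.∧-distribˡ-xor (A m) _ _ ⟨
    A m ∧ (interval (lo m) (hi m) c xor interval (lo m) (hi m) (suc c))
      ≡⟨ cong (A m ∧_) (interval-jump (lo m) (hi m) c) ⟩
    A m ∧ incident m (suc c) ∎)
    where open ≡-Reasoning

  even⇔flat : ∀ A → Even A ⇔ (∀ c → layer A c ≡ false)
  even⇔flat A = mk⇔ flat even
    where
    flat : Even A → ∀ c → layer A c ≡ false
    flat A-even zero    = trans (layer-start A) (A-even 0)
    flat A-even (suc c) = trans (cong (_xor layer A (suc c)) (sym (flat A-even c)))
                                (trans (layer-jump A c) (A-even (suc c)))
    even : (∀ c → layer A c ≡ false) → Even A
    even A-flat zero    = trans (sym (layer-start A)) (A-flat 0)
    even A-flat (suc c) = trans (sym (layer-jump A c)) (cong₂ _xor_ (A-flat c) (A-flat (suc c)))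

  record Cycle (M : ℕ) : Set where
    field
      vertex : Fin (suc M) → ℕ
      vertex-injective : Injective _≡_ _≡_ vertex
      edge : Fin (suc M) → Fin k
      edge-joins : ∀ t → Joins (edge t) (vertex t) (vertex (sucMod t))

  Covers : ∀ {M} → Cycle M → Set
  Covers C = ∀ m → ∃[ t ] Cycle.edge C t ≡ m

  module CycleFacts {M : ℕ} (2≤M : 2 ≤ M) (C : Cycle M) where
    open Cycle C

    edge-injective : Injective _≡_ _≡_ edge
    edge-injective {t} {t′} et≡et′
      with joins-endpoints (edge-joins t) (subst (λ m → Joins m _ _) (sym et≡et′) (edge-joins t′))
    ... | inj₁ (vt≡vt′ , _) = vertex-injective vt≡vt′
    ... | inj₂ (vt≡vst′ , vst≡vt′) = contradiction
          (trans (cong sucMod (sym (vertex-injective vt≡vst′))) (vertex-injective vst≡vt′))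
          (sucMod²-moves 2≤M t′)

    cycle-edge-at : ∀ {t p} → incident (edge t) p ≡ true → p ≡ vertex t ⊎ p ≡ vertex (sucMod t)
    cycle-edge-at {t} e∋p = incident-joins e∋p (edge-joins t)

    EdgeSet : (Fin k → Bool) → Set
    EdgeSet A = ∀ m → A m ≡ true ⇔ (∃[ t ] edge t ≡ m)

    -- The edge set of a cycle is even: a vertex of the cycle meets exactly two
    -- cycle edges, any other vertex none.
    edge-set-even : ∀ A → EdgeSet A → Even A
    edge-set-even A A-edges p with Fin.any? (λ t → vertex t ≟ p)
    ... | no off = parity-none k _ λ m → ∧-false λ Am m∋p → off (on-cycle m Am m∋p)
      where
      on-cycle : ∀ m → A m ≡ true → incident m p ≡ true → ∃[ t ] vertex t ≡ p
      on-cycle m Am m∋p with to (A-edges m) Am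
      ... | t , refl = [ (λ p≡vt → t , sym p≡vt) , (λ p≡vst → sucMod t , sym p≡vst) ]′ (cycle-edge-at m∋p)
    ... | yes (t , vt≡p) = parity-two k _ (edge s) (edge t) (s≢t ∘ edge-injective)
          (cong₂ _∧_ (from (A-edges (edge s)) (s , refl)) arrives)
          (cong₂ _∧_ (from (A-edges (edge t)) (t , refl)) leaves)
          λ m m≢es m≢et → ∧-false (other m m≢es m≢et)
      where
      s : Fin (suc M)
      s = proj₁ (sucMod-surjective t)
      s↦t : sucMod s ≡ t
      s↦t = proj₂ (sucMod-surjective t)
      s≢t : s ≢ t
      s≢t s≡t = sucMod-moves (ℕ.<-trans (s≤s z≤n) 2≤M) t (trans (cong sucMod (sym s≡t)) s↦t)
      arrives : incident (edge s) p ≡ true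
      arrives = joins-incident (joins-sym
        (subst (Joins (edge s) (vertex s)) (trans (cong vertex s↦t) vt≡p) (edge-joins s)))
      leaves : incident (edge t) p ≡ true
      leaves = joins-incident (subst (λ x → Joins (edge t) x (vertex (sucMod t))) vt≡p (edge-joins t))
      other : ∀ m → m ≢ edge s → m ≢ edge t → A m ≡ true → incident m p ≡ true → ⊥
      other m m≢es m≢et Am m∋p with to (A-edges m) Am
      ... | t′ , refl =
        [ (λ p≡vt′ → m≢et (cong edge (vertex-injective (trans (sym p≡vt′) (sym vt≡p)))))
        , (λ p≡vst′ → m≢es (cong edge (sucMod-injective
                        (trans (vertex-injective (trans (sym p≡vst′) (sym vt≡p))) (sym s↦t)))))
        ]′ (cycle-edge-at m∋p)

    -- A cycle through all edges leaves no proper non-empty part of them even: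
    -- at the vertex where the cycle leaves such a part, the part has degree one.
    covering-minimal : Covers C → Minimal
    covering-minimal cover B (m₁ , Bm₁) (m₂ , Bm₂) B-even
      with boundary (B ∘ edge) (trans (cong B (proj₂ (cover m₁))) Bm₁)
                               (trans (cong B (proj₂ (cover m₂))) Bm₂)
    ... | t , Bet , Best = contradiction (trans (sym (B-even p)) odd) λ ()
      where
      p : ℕ
      p = vertex (sucMod t)
      other : ∀ m → m ≢ edge t → B m ≡ true → incident m p ≡ true → ⊥
      other m m≢et Bm m∋p with cover m
      ... | t′ , refl = [ (λ p≡vt′ → contradiction (trans (sym Bm)
                              (trans (cong (B ∘ edge) (sym (vertex-injective p≡vt′))) Best)) λ ())
                        , (λ p≡vst′ → m≢et (cong edge (sucMod-injective (vertex-injective (sym p≡vst′)))))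
                        ]′ (cycle-edge-at m∋p)
      odd : odd-degree B p ≡ true
      odd = parity-one k _ (edge t) (cong₂ _∧_ Bet (joins-incident (joins-sym (edge-joins t))))
              λ m m≢et → ∧-false (other m m≢et)

    covering-length : Covers C → suc M ≡ k
    covering-length cover = ℕ.≤-antisym (Fin.injective⇒≤ edge-injective)
      (Fin.injective⇒≤ {f = proj₁ ∘ cover} λ {m} {m′} same →
        trans (sym (proj₂ (cover m))) (trans (cong edge same) (proj₂ (cover m′))))

  record Trail : Set where
    field
      at : ℕ → ℕ
      via : ℕ → Fin k
      via-joins : ∀ r → Joins (via r) (at r) (at (suc r))
      no-backtracking : ∀ r → via (suc r) ≢ via r

  module FirstReturn (T : Trail) {i j : ℕ} (i<j : i < j) (returns : Trail.at T i ≡ Trail.at T j)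
    (distinct : ∀ a b → a < j → b < j → Trail.at T a ≡ Trail.at T b → a ≡ b) where
    open Trail T

    -- The closed part has at least three edges: there are no loops, and an
    -- immediate return would reuse the edge.
    long : ∃[ M ] 2 ≤ M × i + suc M ≡ j
    long = by-length (j ∸ i) (ℕ.m+[n∸m]≡n (ℕ.<⇒≤ i<j))
      where
      back-to : ∀ {r} → r ≡ j → at r ≡ at i
      back-to r≡j = trans (cong at r≡j) (sym returns)
      by-length : ∀ L → i + L ≡ j → ∃[ M ] 2 ≤ M × i + suc M ≡ j
      by-length 0 i+0≡j = contradiction (trans (sym (ℕ.+-identityʳ i)) i+0≡j) (ℕ.<⇒≢ i<j)
      by-length 1 i+1≡j = contradiction
        (subst (Joins (via i) (at i)) (back-to (trans (ℕ.+-comm 1 i) i+1≡j)) (via-joins i)) joins-loop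
      by-length 2 i+2≡j = ⊥-elim (no-backtracking i (joins-edge (joins-sym
        (subst (Joins (via (suc i)) (at (suc i))) (back-to (trans (ℕ.+-comm 2 i) i+2≡j))
               (via-joins (suc i)))) (via-joins i)))
      by-length (suc (suc (suc L))) i+L≡j = suc (suc L) , s≤s (s≤s z≤n) , i+L≡j

    closed-cycle : ∀ M → i + suc M ≡ j → Cycle M
    closed-cycle M i+1+M≡j = record
      { vertex = at ∘ position
      ; vertex-injective = λ {t} {t′} same → Fin.toℕ-injective
          (ℕ.+-cancelˡ-≡ i _ _ (distinct _ _ (before-return t) (before-return t′) same))
      ; edge = via ∘ position
      ; edge-joins = λ t → subst (Joins _ _) (next t) (via-joins (position t))
      }
      where
      position : Fin (suc M) → ℕ
      position t = i + toℕ t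
      before-return : ∀ t → position t < j
      before-return t = subst (position t <_) i+1+M≡j (ℕ.+-monoʳ-< i (Fin.toℕ<n t))
      next : ∀ t → at (suc (position t)) ≡ at (position (sucMod t))
      next t with sucMod-cases t
      ... | inj₁ (_ , st) = cong at (trans (sym (ℕ.+-suc i (toℕ t))) (cong (i +_) (sym st)))
      ... | inj₂ (t≡M , st≡0) = begin
        at (suc (i + toℕ t))   ≡⟨ cong at (trans (sym (ℕ.+-suc i (toℕ t))) (cong (λ x → i + suc x) t≡M)) ⟩
        at (i + suc M)         ≡⟨ cong at i+1+M≡j ⟩
        at j                   ≡⟨ returns ⟨
        at i                   ≡⟨ cong at (ℕ.+-identityʳ i) ⟨
        at (i + 0)             ≡⟨ cong (at ∘ position) st≡0 ⟨
        at (position (sucMod t)) ∎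
        where open ≡-Reasoning

  -- A trail confined to the vertices below N returns to a vertex (pigeonhole);
  -- its first return closes a cycle.
  module Confined (T : Trail) {N : ℕ} (below : ∀ r → Trail.at T r < N) where
    open Trail T

    Returns : ℕ → Set
    Returns j = ∃[ i ] i < j × at i ≡ at j

    returns? : ∀ j → Dec (Returns j)
    returns? j = ℕ.anyUpTo? (λ i → at i ≟ at j) j

    some-return : ∃[ j ] Returns j
    some-return with Fin.pigeonhole (ℕ.n<1+n N) (λ (r : Fin (suc N)) → fromℕ< (below (toℕ r)))
    ... | r₁ , r₂ , r₁<r₂ , same = toℕ r₂ , toℕ r₁ , r₁<r₂ ,
      trans (sym (Fin.toℕ-fromℕ< _)) (trans (cong toℕ same) (Fin.toℕ-fromℕ< _))

    first-return : ∃[ j ] Returns j × (∀ j′ → j′ < j → ¬ Returns j′)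
    first-return = least returns? (proj₂ some-return)

    j : ℕ
    j = proj₁ first-return

    i : ℕ
    i = proj₁ (proj₁ (proj₂ first-return))

    i<j : i < j
    i<j = proj₁ (proj₂ (proj₁ (proj₂ first-return)))

    returns : at i ≡ at j
    returns = proj₂ (proj₂ (proj₁ (proj₂ first-return)))

    distinct : ∀ a b → a < j → b < j → at a ≡ at b → a ≡ b
    distinct a b a<j b<j same with ℕ.<-cmp a b
    ... | tri< a<b _ _ = contradiction (a , a<b , same) (proj₂ (proj₂ first-return) b b<j)
    ... | tri≈ _ a≡b _ = a≡b
    ... | tri> _ _ b<a = contradiction (b , b<a , sym same) (proj₂ (proj₂ first-return) a a<j)

    open FirstReturn T i<j returns distinct

    cycle : ∃[ M ] 2 ≤ M × Cycle M
    cycle = proj₁ long , proj₁ (proj₂ long) , closed-cycle (proj₁ long) (proj₂ (proj₂ long))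

  -- When every vertex has even degree, a walk can always continue without
  -- backtracking.
  module EvenWalk (even : Even (λ _ → true)) where

    companion : ∀ f x → incident f x ≡ true → ∃[ g ] g ≢ f × incident g x ≡ true
    companion f x f∋x with Fin.any? (λ g → ¬? (g Fin.≟ f) ×-dec (incident g x Bool.≟ true))
    ... | yes found = found
    ... | no none = contradiction (trans (sym (even x))
          (parity-one k (λ m → incident m x) f f∋x λ g g≢f → Bool.¬-not (λ g∋x → none (g , g≢f , g∋x))))
          λ ()

    far-end : Fin k → ℕ → ℕ
    far-end g x with x ≟ lo g
    ... | yes _ = hi g
    ... | no  _ = lo g

    far-end-joins : ∀ {g x} → incident g x ≡ true → Joins g x (far-end g x)
    far-end-joins {g} {x} g∋x with x ≟ lo g
    ... | yes x≡lo = inj₁ (sym x≡lo , refl)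
    ... | no  x≢lo = inj₂ (refl , [ (λ x≡lo → contradiction x≡lo x≢lo) , sym ]′ (incident-endpoint g∋x))

    -- A vertex together with an edge at it (the edge the walk arrived by).
    Position : Set
    Position = Σ ℕ λ x → Σ (Fin k) λ f → incident f x ≡ true

    advance : Position → Position
    advance (x , f , f∋x) = far-end g x , g , joins-incident (joins-sym (far-end-joins {g} {x} g∋x))
      where
      g : Fin k
      g = proj₁ (companion f x f∋x)
      g∋x : incident g x ≡ true
      g∋x = proj₂ (proj₂ (companion f x f∋x))

    position : Fin k → ℕ → Position
    position m₀ zero    = hi m₀ , m₀ , joins-incident (inj₂ (refl , refl))
    position m₀ (suc r) = advance (position m₀ r)

    trail : Fin k → Trail
    trail m₀ = record
      { at = proj₁ ∘ position m₀
      ; via = λ r → proj₁ (proj₂ (position m₀ (suc r)))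
      ; via-joins = λ r → far-end-joins (proj₂ (proj₂ (companion′ (position m₀ r))))
      ; no-backtracking = λ r → proj₁ (proj₂ (companion′ (position m₀ (suc r))))
      }
      where
      companion′ : (s : Position) → ∃[ g ] g ≢ proj₁ (proj₂ s) × incident g (proj₁ s) ≡ true
      companion′ (x , f , f∋x) = companion f x f∋x

    trail-below : ∀ {N} → (∀ m → hi m < N) → ∀ m₀ r → Trail.at (trail m₀) r < N
    trail-below hi<N m₀ zero    = hi<N m₀
    trail-below hi<N m₀ (suc r) = proj₂ (joins-below hi<N (Trail.via-joins (trail m₀) r))

  -- An even, minimal set of edges bounded by N, with an edge m₀, is run through
  -- by a cycle: the walk from m₀ closes a cycle, whose edge set is even and
  -- non-empty, hence everything.
  minimal-even-cycle : ∀ {N} → (∀ m → hi m < N) → Minimal → Even (λ _ → true) → Fin k →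
    ∃[ M ] 2 ≤ M × Σ (Cycle M) Covers
  minimal-even-cycle hi<N minimal even m₀ =
    M , 2≤M , C , λ m → does-sound (on-cycle? m) (everything m)
    where
    open EvenWalk even
    found : ∃[ M ] 2 ≤ M × Cycle M
    found = Confined.cycle (trail m₀) (trail-below hi<N m₀)
    M : ℕ
    M = proj₁ found
    2≤M : 2 ≤ M
    2≤M = proj₁ (proj₂ found)
    C : Cycle M
    C = proj₂ (proj₂ found)
    open CycleFacts 2≤M C
    on-cycle? : ∀ m → Dec (∃[ t ] Cycle.edge C t ≡ m)
    on-cycle? m = Fin.any? (λ t → Cycle.edge C t Fin.≟ m)
    edges : Fin k → Bool
    edges m = does (on-cycle? m)
    edges-even : Even edges
    edges-even = edge-set-even edges λ m → mk⇔ (does-sound (on-cycle? m)) (dec-true (on-cycle? m))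
    everything : ∀ m → edges m ≡ true
    everything m = Bool.¬-not λ off →
      minimal edges (Cycle.edge C fzero , dec-true (on-cycle? _) (fzero , refl)) (m , off) edges-even

  cycle⇔minimal-even : ∀ {N M} → (∀ m → hi m < N) → 2 ≤ M → suc M ≡ k →
    Σ (Cycle M) Covers ⇔ (Minimal × Even (λ _ → true))
  cycle⇔minimal-even {M = M} hi<N 2≤M 1+M≡k = mk⇔
    (λ (C , cover) → CycleFacts.covering-minimal 2≤M C cover ,
                     CycleFacts.edge-set-even 2≤M C (λ _ → true) (λ m → mk⇔ (λ _ → cover m) (λ _ → refl)))
    (λ (minimal , even) → same-length (minimal-even-cycle hi<N minimal even (subst Fin 1+M≡k fzero)))
    where
    same-length : ∃[ M′ ] 2 ≤ M′ × Σ (Cycle M′) Covers → Σ (Cycle M) Covers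
    same-length (M′ , 2≤M′ , C , cover) = subst (λ L → Σ (Cycle L) Covers)
      (ℕ.suc-injective (trans (CycleFacts.covering-length 2≤M′ C cover) (sym 1+M≡k))) (C , cover)

module IntervalsOf {n M : ℕ} (e : Fin (suc M) → Vec Bool (n ∸ 1))
  (e-injective : Injective _≡_ _≡_ e) (convex : ∀ m → InC (e m)) where

  first last : Fin (suc M) → Fin (n ∸ 1)
  first m = proj₁ (stretch-of (convex m))
  last m = proj₁ (proj₂ (stretch-of (convex m)))

  stretch : ∀ m → Stretch (e m) (first m) (last m)
  stretch m = proj₂ (proj₂ (stretch-of (convex m)))

  lo hi : Fin (suc M) → ℕ
  lo m = toℕ (first m)
  hi m = suc (toℕ (last m))

  lo<hi : ∀ m → lo m < hi m
  lo<hi m = s≤s (stretch-ordered {v = e m} (stretch m))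

  hi<n : ∀ m → hi m < n
  hi<n m = below-pred (Fin.toℕ<n (last m))
    where
    below-pred : ∀ {x N} → x < N ∸ 1 → suc x < N
    below-pred {N = suc N} x<N = s≤s x<N

  lo<n : ∀ m → lo m < n
  lo<n m = ℕ.<-trans (lo<hi m) (hi<n m)

  lookup-e : ∀ m c → lookup (e m) c ≡ interval (lo m) (hi m) (toℕ c)
  lookup-e m c = lookup-stretch (convex m) (stretch m) c

  simple : ∀ {m m′} → lo m ≡ lo m′ → hi m ≡ hi m′ → m ≡ m′
  simple {m} {m′} lo≡lo′ hi≡hi′ = e-injective (lookup-ext (e m) (e m′) λ c →
    trans (lookup-e m c) (trans (cong₂ (λ l h → interval l h (toℕ c)) lo≡lo′ hi≡hi′) (sym (lookup-e m′ c))))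

  open IntervalGraph lo hi lo<hi simple public

  lookup-Σsel-layer : ∀ A c → lookup (Σsel (suc M) e A) c ≡ layer A (toℕ c)
  lookup-Σsel-layer A c =
    trans (lookup-Σsel (suc M) e A c) (parity-cong (suc M) λ m → cong (A m ∧_) (lookup-e m c))

  layer-beyond : ∀ A c → n ∸ 1 ≤ c → layer A c ≡ false
  layer-beyond A c d≤c = parity-none (suc M) _ λ m →
    trans (cong (A m ∧_) (cong₂ _xor_ (from ray-true (ℕ.≤-trans (ℕ.<⇒≤ (lo<hi m)) (hi≤c m)))
                                      (from ray-true (hi≤c m))))
          (Bool.∧-zeroʳ (A m))
    where
    hi≤c : ∀ m → hi m ≤ c
    hi≤c m = ℕ.≤-trans (Fin.toℕ<n (last m)) d≤c

  sum-zero⇔even : ∀ A → Σsel (suc M) e A ≡ 𝟎 ⇔ Even A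
  sum-zero⇔even A = ⇔.trans (mk⇔ flat zero-sum) (⇔.sym (even⇔flat A))
    where
    open ≡-Reasoning
    flat : Σsel (suc M) e A ≡ 𝟎 → ∀ c → layer A c ≡ false
    flat sum≡𝟎 c with c <? n ∸ 1
    ... | yes c<d = begin
      layer A c                             ≡⟨ cong (layer A) (Fin.toℕ-fromℕ< c<d) ⟨
      layer A (toℕ (fromℕ< c<d))            ≡⟨ lookup-Σsel-layer A (fromℕ< c<d) ⟨
      lookup (Σsel (suc M) e A) (fromℕ< c<d) ≡⟨ cong (λ v → lookup v (fromℕ< c<d)) sum≡𝟎 ⟩
      lookup 𝟎 (fromℕ< c<d)                 ≡⟨ lookup-𝟎 (fromℕ< c<d) ⟩
      false                                 ∎
    ... | no c≮d = layer-beyond A c (ℕ.≮⇒≥ c≮d)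
    zero-sum : (∀ c → layer A c ≡ false) → Σsel (suc M) e A ≡ 𝟎
    zero-sum A-flat = lookup-ext _ 𝟎 λ c →
      trans (lookup-Σsel-layer A c) (trans (A-flat (toℕ c)) (sym (lookup-𝟎 c)))

  reduced⇔minimal : Reduced (suc M) e ⇔ Minimal
  reduced⇔minimal = mk⇔
    (λ reduced A some not-all → reduced A some not-all ∘ from (sum-zero⇔even A))
    (λ minimal A some not-all → minimal A some not-all ∘ to (sum-zero⇔even A))

  -- The vertex a of G(S) becomes the vertex n-1-a of the interval graph.
  mirror : Fin n → ℕ
  mirror a = toℕ (opposite a)

  mirror-injective : Injective _≡_ _≡_ mirror
  mirror-injective {a} {b} same = begin
    a                     ≡⟨ Fin.opposite-involutive a ⟨
    opposite (opposite a) ≡⟨ cong opposite (Fin.toℕ-injective same) ⟩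
    opposite (opposite b) ≡⟨ Fin.opposite-involutive b ⟩
    b                     ∎
    where open ≡-Reasoning

  unmirror : ∀ x → x < n → Fin n
  unmirror x x<n = opposite (fromℕ< x<n)

  mirror-unmirror : ∀ x (x<n : x < n) → mirror (unmirror x x<n) ≡ x
  mirror-unmirror x x<n = trans (cong toℕ (Fin.opposite-involutive _)) (Fin.toℕ-fromℕ< x<n)

  low-end : ∀ a x → toℕ a + x + 1 ≡ n ⇔ x ≡ mirror a
  low-end a x = mk⇔ solve (λ { refl → trans shape (trans (cong (suc (toℕ a) +_) (Fin.opposite-prop a))
                                                          (ℕ.m+[n∸m]≡n (Fin.toℕ<n a))) })
    where
    open ≡-Reasoning
    shape : toℕ a + x + 1 ≡ suc (toℕ a) + x
    shape = ℕ.+-comm (toℕ a + x) 1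
    solve : toℕ a + x + 1 ≡ n → x ≡ mirror a
    solve sum≡n = begin
      x                           ≡⟨ ℕ.m+n∸m≡n (suc (toℕ a)) x ⟨
      suc (toℕ a) + x ∸ suc (toℕ a) ≡⟨ cong (_∸ suc (toℕ a)) (trans (sym shape) sum≡n) ⟩
      n ∸ suc (toℕ a)               ≡⟨ Fin.opposite-prop a ⟨
      mirror a                      ∎

  high-end : ∀ a x → toℕ a + x + 2 ≡ n ⇔ suc x ≡ mirror a
  high-end a x = subst (λ s → (s ≡ n) ⇔ (suc x ≡ mirror a)) shift (low-end a (suc x))
    where
    shift : toℕ a + suc x + 1 ≡ toℕ a + x + 2
    shift = trans (cong (_+ 1) (ℕ.+-suc (toℕ a) x)) (sym (ℕ.+-suc (toℕ a + x) 1))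

  edge⇔joins : ∀ m a b → EdgeOf n (e m) a b ⇔ Joins m (mirror a) (mirror b)
  edge⇔joins m a b = mk⇔ joins edge
    where
    joins : EdgeOf n (e m) a b → Joins m (mirror a) (mirror b)
    joins (i , j , s , ends) with stretch-unique {v = e m} (stretch m) s
    joins (i , j , s , inj₁ (lo-a , hi-b)) | i≡ , j≡ =
      inj₁ (trans i≡ (to (low-end a (toℕ i)) lo-a) , trans (cong suc j≡) (to (high-end b (toℕ j)) hi-b))
    joins (i , j , s , inj₂ (lo-b , hi-a)) | i≡ , j≡ =
      inj₂ (trans i≡ (to (low-end b (toℕ i)) lo-b) , trans (cong suc j≡) (to (high-end a (toℕ j)) hi-a))
    edge : Joins m (mirror a) (mirror b) → EdgeOf n (e m) a b
    edge (inj₁ (lo≡ , hi≡)) =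
      first m , last m , stretch m , inj₁ (from (low-end a _) lo≡ , from (high-end b _) hi≡)
    edge (inj₂ (lo≡ , hi≡)) =
      first m , last m , stretch m , inj₂ (from (low-end b _) lo≡ , from (high-end a _) hi≡)

  k-cycle⇔cycle : IsKCycle n (suc M) e ⇔ Σ (Cycle M) Covers
  k-cycle⇔cycle = mk⇔ cycle-of k-cycle-of
    where
    cycle-of : IsKCycle n (suc M) e → Σ (Cycle M) Covers
    cycle-of (w , w-injective , adjacency) = C , cover
      where
      step : ∀ t → Adj n (suc M) e (w t) (w (sucMod t))
      step t = proj₂ (adjacency (w t) (w (sucMod t))) t (inj₁ (refl , refl))
      C : Cycle M
      C = record
        { vertex = mirror ∘ w
        ; vertex-injective = w-injective ∘ mirror-injective
        ; edge = proj₁ ∘ step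
        ; edge-joins = λ t → to (edge⇔joins _ _ _) (proj₂ (step t))
        }
      cover : Covers C
      cover m = step-of (proj₁ (adjacency a b) (m , from (edge⇔joins m a b) ab))
        where
        a b : Fin n
        a = unmirror (lo m) (lo<n m)
        b = unmirror (hi m) (hi<n m)
        ab : Joins m (mirror a) (mirror b)
        ab = inj₁ (sym (mirror-unmirror (lo m) (lo<n m)) , sym (mirror-unmirror (hi m) (hi<n m)))
        step-of : ∃[ t ] ((a ≡ w t × b ≡ w (sucMod t)) ⊎ (b ≡ w t × a ≡ w (sucMod t))) →
          ∃[ t ] Cycle.edge C t ≡ m
        step-of (t , inj₁ (a≡wt , b≡wst)) = t , joins-edge (Cycle.edge-joins C t)
          (subst₂ (Joins m) (cong mirror a≡wt) (cong mirror b≡wst) ab)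
        step-of (t , inj₂ (b≡wt , a≡wst)) = t , joins-edge (Cycle.edge-joins C t)
          (joins-sym (subst₂ (Joins m) (cong mirror a≡wst) (cong mirror b≡wt) ab))
    k-cycle-of : Σ (Cycle M) Covers → IsKCycle n (suc M) e
    k-cycle-of (C , cover) = w , w-injective , λ a b → adjacent a b , step a b
      where
      open Cycle C
      w : Fin (suc M) → Fin n
      vertex<n : ∀ t → vertex t < n
      vertex<n t = proj₁ (joins-below hi<n (edge-joins t))
      w t = unmirror (vertex t) (vertex<n t)
      mirror-w : ∀ t → mirror (w t) ≡ vertex t
      mirror-w t = mirror-unmirror (vertex t) (vertex<n t)
      w-injective : Injective _≡_ _≡_ w
      w-injective same = vertex-injective (trans (sym (mirror-w _)) (trans (cong mirror same) (mirror-w _)))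
      is-w : ∀ {a t} → mirror a ≡ vertex t → a ≡ w t
      is-w ma≡vt = mirror-injective (trans ma≡vt (sym (mirror-w _)))
      step-joins : ∀ t → Joins (edge t) (mirror (w t)) (mirror (w (sucMod t)))
      step-joins t = subst₂ (Joins (edge t)) (sym (mirror-w t)) (sym (mirror-w (sucMod t))) (edge-joins t)
      adjacent : ∀ a b → Adj n (suc M) e a b →
        ∃[ t ] ((a ≡ w t × b ≡ w (sucMod t)) ⊎ (b ≡ w t × a ≡ w (sucMod t)))
      adjacent a b (m , ab) with cover m
      ... | t , refl with joins-endpoints (to (edge⇔joins (edge t) a b) ab) (edge-joins t)
      ...   | inj₁ (ma≡vt , mb≡vst) = t , inj₁ (is-w ma≡vt , is-w mb≡vst)
      ...   | inj₂ (ma≡vst , mb≡vt) = t , inj₂ (is-w mb≡vt , is-w ma≡vst)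
      step : ∀ a b t → (a ≡ w t × b ≡ w (sucMod t)) ⊎ (b ≡ w t × a ≡ w (sucMod t)) →
        Adj n (suc M) e a b
      step a b t (inj₁ (refl , refl)) = edge t , from (edge⇔joins _ a b) (step-joins t)
      step a b t (inj₂ (refl , refl)) = edge t , from (edge⇔joins _ a b) (joins-sym (step-joins t))

-- For k ≥ 3 distinct vectors of C(n-1), G̃(S) is a k-cycle iff S is reduced
-- and sums to 0.
lemma1 : (k n : ℕ) → 3 ≤ k → k ≤ n →
    (e : Fin k → Vec Bool (n ∸ 1)) → Injective _≡_ _≡_ e → (∀ m → InC (e m)) →
    IsKCycle n k e ⇔ (Reduced k e × Σv k e ≡ 𝟎)
lemma1 (suc M) n (s≤s 2≤M) _ e e-injective convex =
  ⇔.trans k-cycle⇔cycle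
  (⇔.trans (cycle⇔minimal-even hi<n 2≤M refl)
           (⇔.sym (reduced⇔minimal ×-⇔ sum-zero⇔even (λ _ → true))))
  where open IntervalsOf {n} e e-injective convex
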